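{- Let $A,B\in\mathbb{R}^2$ be orthogonal vectors of equal length and $\Lambda=\mathbb{Z}A+\mathbb{Z}B$. Let $\psi$ be the rotation by $90^\circ$ about the origin and $r_1'$ the reflection in the line $\mathbb{R}A$. For every positive integer $n$, the number of subgroups $K\le\Lambda$ of index $n$ with $\psi(K)=K$ and $r_1'(K)=K$ (i.e. invariant under the full group of symmetries of $\Lambda$ fixing the origin) equals $$f_6(n)=\begin{cases}0,&\text{if } v_p(n)\text{ is odd for some odd prime } p,\\ 1,&\text{otherwise,}\end{cases}$$ where $v_p(n)$ is the exponent of $p$ in $n$.
   Context: This concerns $n$-sheeted toroidal covers $X=E/K$ of the minimal map of a tiling of type $[3^1,12^2;3^1,4^1,3^1,12^1]$ whose isotropy group (point symmetry group modulo translations) is the dihedral group of order $8$ generated by $\psi$ and $r_1'$; the covers whose isotropy group equals that of the tiling are exactly those with $K$ invariant under $\psi$ and $r'_1$. -}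

module Defs where

open import Data.Nat as ℕ using (ℕ; suc; _^_)
open import Data.Nat.Divisibility using (_∣_)
open import Data.Nat.Primality using (Prime)
open import Data.Empty using (⊥)
open import Data.Integer as ℤ using (ℤ; 0ℤ)
open import Data.Product using (_×_; _,_; Σ; ∃)
open import Data.Fin using (Fin)
open import Relation.Binary.PropositionalEquality using (_≡_)
open import Relation.Nullary using (¬_)
open import Function.Bundles using (_⇔_)

-- The lattice Λ = ℤA + ℤB, identified with ℤ² via coordinates w.r.t. the basis (A , B):
-- (a , b) stands for a·A + b·B.
Λ : Set
Λ = ℤ × ℤ

_⊕_ : Λ → Λ → Λ
(a , b) ⊕ (c , d) = (a ℤ.+ c , b ℤ.+ d)

⊖_ : Λ → Λ
⊖ (a , b) = (ℤ.- a , ℤ.- b)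

_⊝_ : Λ → Λ → Λ
v ⊝ w = v ⊕ (⊖ w)

𝟘 : Λ
𝟘 = (0ℤ , 0ℤ)

-- ψ : rotation by 90° about the origin.  Since A ⊥ B and |A| = |B|, ψ(A) = B and ψ(B) = -A
-- (orienting so that (A , B) is positively oriented).
ψ : Λ → Λ
ψ (a , b) = (ℤ.- b , a)

r₁' : Λ → Λ
r₁' (a , b) = (a , ℤ.- b)

record IsSubgroup (K : Λ → Set) : Set where
  field
    has-𝟘  : K 𝟘
    closed-⊕ : ∀ {v w} → K v → K w → K (v ⊕ w)
    closed-⊖ : ∀ {v} → K v → K (⊖ v)

HasIndex : (K : Λ → Set) → ℕ → Set
HasIndex K n = Σ (Fin n → Λ) λ r →
  (∀ v → ∃ λ i → K (v ⊝ r i)) × (∀ i j → K (r i ⊝ r j) → i ≡ j)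

MapsOnto : (Λ → Λ) → (Λ → Set) → Set
MapsOnto f K = (∀ v → K v → K (f v)) × (∀ w → K w → ∃ λ v → K v × f v ≡ w)

Invariant : (Λ → Set) → Set
Invariant K = MapsOnto ψ K × MapsOnto r₁' K

Good : ℕ → (Λ → Set) → Set
Good n K = IsSubgroup K × HasIndex K n × Invariant K

Odd : ℕ → Set
Odd n = ∃ λ m → n ≡ suc (2 ℕ.* m)

Val : ℕ → ℕ → ℕ → Set
Val p n k = (p ^ k ∣ n) × ¬ (p ^ suc k ∣ n)

OddValAtOddPrime : ℕ → Set
OddValAtOddPrime n = ∃ λ p → Prime p × Odd p × ∃ λ k → Val p n k × Odd k

NoneGood : ℕ → Set₁
NoneGood n = ∀ K → Good n K → ⊥

UniqueGood : ℕ → Set₁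
UniqueGood n = Σ (Λ → Set) λ K → Good n K × (∀ K' → Good n K' → ∀ v → K v ⇔ K' v)

-- Let K be a ψ- and r₁'-invariant subgroup of finite index, d the least positive first
-- coordinate of a point of K, and (d , Y) ∈ K.  Division with remainder by (d , Y) puts
-- every first coordinate of a point of K in dℤ, hence (rotating by ψ) every second one
-- too, and (d , Y) + r₁'(d , Y) = (2d , 0) puts (0 , 2d) in K.  If (d , 0) ∈ K then
-- K = dℤ × dℤ, of index d².  Otherwise (d , d) ∈ K but (0 , d) ∉ K, and K is the lattice
-- spanned by (d , d) and (0 , 2d), of index 2d².  So there is exactly one invariant
-- subgroup of index n if n is a square or twice a square, and none otherwise; as p-adic
-- valuations are additive, n has this form iff v_p(n) is even at every odd prime p.
module Submission where

open import Defs
open import Data.Nat using (ℕ; _≥_)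
open import Data.Product using (_×_)
open import Relation.Nullary using (¬_)

open import Data.Nat using (zero; suc; _+_; _*_; _^_; _∸_; _<_; _≤_; NonZero; z≤n; s≤s;
                            ≢-nonZero; >-nonZero; >-nonZero⁻¹; nonTrivial⇒n>1)
import Data.Nat.Properties as ℕP
open import Data.Nat.Divisibility
  using (_∣_; divides; ∣-trans; ∣-refl; 1∣_; ∣1⇒≡1; m∣m*n; *-pres-∣; *-cancelˡ-∣; _∣?_; >⇒∤)
open import Data.Nat.Induction using (<-rec)
open import Data.Nat.Primality
  using (Prime; prime; euclidsLemma; prime⇒irreducible; prime⇒nonZero; ¬prime[1]; prime[2])
open import Data.Nat.Primality.Factorisation using (factorise; PrimeFactorisation)
open import Data.Nat.ListAction using (product)
import Data.Nat.Tactic.RingSolver as ℕ-Solver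
open import Data.Integer as ℤ using (ℤ; +_; -[1+_]; 0ℤ; _/ℕ_; _%ℕ_)
import Data.Integer.Properties as ℤP
open import Data.Integer.DivMod using (a≡a%ℕn+[a/ℕn]*n; n%ℕd<d)
open import Data.Integer.Divisibility.Signed as ℤ∣
  using (divides; ∣m∣n⇒∣m+n; ∣m⇒∣-m; ∣m∣n⇒∣m-n; ∣m+n∣m⇒∣n; ∣⇒∣ᵤ)
  renaming (_∣_ to _∣ℤ_)
open import Data.Integer.Tactic.RingSolver using (solve-∀)
open import Data.Fin as Fin using (Fin; toℕ; fromℕ<; combine; remQuot)
import Data.Fin.Properties as FinP
open import Data.List using ([]; _∷_)
open import Data.List.Relation.Unary.All using (_∷_)
open import Data.Product using (∃; ∃₂; _,_; proj₁; proj₂; uncurry)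
open import Data.Sum using (_⊎_; inj₁; inj₂; [_,_])
open import Function using (_∘_)
open import Function.Bundles using (_⇔_; mk⇔; Equivalence)
open import Relation.Binary using (tri<; tri≈; tri>)
open import Relation.Binary.PropositionalEquality
  using (_≡_; _≢_; refl; sym; trans; cong; cong₂; subst; module ≡-Reasoning)
open import Relation.Nullary using (Dec; yes; no; contradiction)
import Relation.Nullary.Decidable as Dec

infixr 7 _·_
_·_ : ℤ → Λ → Λ
k · (a , b) = (k ℤ.* a , k ℤ.* b)

infix 4 _≐_
_≐_ : (Λ → Set) → (Λ → Set) → Set
K ≐ K′ = ∀ v → K v ⇔ K′ v

≐-sym : ∀ {K K′} → K ≐ K′ → K′ ≐ K
≐-sym K≐K′ v = mk⇔ (Equivalence.from (K≐K′ v)) (Equivalence.to (K≐K′ v))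

-- Congruence subgroups

residue : ∀ m .{{_ : NonZero m}} → ℤ → Fin m
residue m x = fromℕ< (n%ℕd<d x m)

∣-minus-residue : ∀ m .{{_ : NonZero m}} x → + m ∣ℤ x ℤ.- + toℕ (residue m x)
∣-minus-residue m x = divides (x /ℕ m) (begin
  x ℤ.- + toℕ (residue m x)                    ≡⟨ cong (λ r → x ℤ.- + r) (FinP.toℕ-fromℕ< _) ⟩
  x ℤ.- + r                                    ≡⟨ cong (ℤ._- + r) (a≡a%ℕn+[a/ℕn]*n x m) ⟩
  + r ℤ.+ x /ℕ m ℤ.* + m ℤ.- + r               ≡⟨ cancel (+ r) (x /ℕ m ℤ.* + m) ⟩
  x /ℕ m ℤ.* + m                               ∎)
  where
  open ≡-Reasoning
  r : ℕ
  r = x %ℕ m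
  cancel : ∀ r s → r ℤ.+ s ℤ.- r ≡ s
  cancel = solve-∀

%ℕ-as-difference : ∀ x m .{{_ : NonZero m}} → x ℤ.- x /ℕ m ℤ.* + m ≡ + (x %ℕ m)
%ℕ-as-difference x m = begin
  x ℤ.- x /ℕ m ℤ.* + m                         ≡⟨ cong (ℤ._- x /ℕ m ℤ.* + m) (a≡a%ℕn+[a/ℕn]*n x m) ⟩
  + (x %ℕ m) ℤ.+ x /ℕ m ℤ.* + m ℤ.- x /ℕ m ℤ.* + m ≡⟨ cancel (+ (x %ℕ m)) (x /ℕ m ℤ.* + m) ⟩
  + (x %ℕ m)                                   ∎
  where
  open ≡-Reasoning
  cancel : ∀ r s → r ℤ.+ s ℤ.- s ≡ r
  cancel = solve-∀

residue-unique : ∀ {m} {a b : Fin m} → + m ∣ℤ + toℕ a ℤ.- + toℕ b → a ≡ b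
residue-unique {m} {a} {b} m∣a-b =
  FinP.toℕ-injective (ℤP.+-injective (ℤP.i-j≡0⇒i≡j _ _ (ℤP.∣i∣≡0⇒i≡0 ∣a-b∣≡0)))
  where
  ∣a-b∣<m : ℤ.∣ + toℕ a ℤ.- + toℕ b ∣ < m
  ∣a-b∣<m = subst (_< m) (cong ℤ.∣_∣ (sym (ℤP.[+m]-[+n]≡m⊖n (toℕ a) (toℕ b))))
              (ℕP.≤-<-trans (ℤP.∣m⊝n∣≤m⊔n (toℕ a) (toℕ b)) (ℕP.⊔-lub (FinP.toℕ<n a) (FinP.toℕ<n b)))
  ∣a-b∣≡0 : ℤ.∣ + toℕ a ℤ.- + toℕ b ∣ ≡ 0
  ∣a-b∣≡0 with ℤ.∣ + toℕ a ℤ.- + toℕ b ∣ | ∣⇒∣ᵤ m∣a-b | ∣a-b∣<m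
  ... | zero  | _   | _   = refl
  ... | suc _ | m∣k | k<m = contradiction m∣k (>⇒∤ k<m)

Congruence : ℕ → ℕ → Λ → Set
Congruence m₁ m₂ (x , y) = + m₁ ∣ℤ x × + m₂ ∣ℤ y

congruence-subgroup : ∀ m₁ m₂ → IsSubgroup (Congruence m₁ m₂)
congruence-subgroup m₁ m₂ = record
  { has-𝟘    = divides 0ℤ refl , divides 0ℤ refl
  ; closed-⊕ = λ (m₁∣x , m₂∣y) (m₁∣x′ , m₂∣y′) → ∣m∣n⇒∣m+n m₁∣x m₁∣x′ , ∣m∣n⇒∣m+n m₂∣y m₂∣y′
  ; closed-⊖ = λ (m₁∣x , m₂∣y) → ∣m⇒∣-m m₁∣x , ∣m⇒∣-m m₂∣y
  }

congruence-index : ∀ m₁ m₂ .{{_ : NonZero m₁}} .{{_ : NonZero m₂}} →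
                   HasIndex (Congruence m₁ m₂) (m₁ * m₂)
congruence-index m₁ m₂ = rep , covered , distinct
  where
  split : Fin (m₁ * m₂) → Fin m₁ × Fin m₂
  split = remQuot m₂

  rep : Fin (m₁ * m₂) → Λ
  rep i = + toℕ (proj₁ (split i)) , + toℕ (proj₂ (split i))

  covered : ∀ v → ∃ λ i → Congruence m₁ m₂ (v ⊝ rep i)
  covered (x , y) = combine (residue m₁ x) (residue m₂ y) ,
    subst (λ (a , b) → Congruence m₁ m₂ ((x , y) ⊝ (+ toℕ a , + toℕ b)))
      (sym (FinP.remQuot-combine (residue m₁ x) (residue m₂ y)))
      (∣-minus-residue m₁ x , ∣-minus-residue m₂ y)

  distinct : ∀ i j → Congruence m₁ m₂ (rep i ⊝ rep j) → i ≡ j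
  distinct i j (m₁∣ , m₂∣) = begin
    i                         ≡⟨ FinP.combine-remQuot {m₁} m₂ i ⟨
    uncurry combine (split i) ≡⟨ cong (uncurry combine) (cong₂ _,_ (residue-unique m₁∣) (residue-unique m₂∣)) ⟩
    uncurry combine (split j) ≡⟨ FinP.combine-remQuot {m₁} m₂ j ⟩
    j                         ∎
    where open ≡-Reasoning

module _ (f : Λ → Λ) (f-⊕ : ∀ v w → f (v ⊕ w) ≡ f v ⊕ f w) (f-⊖ : ∀ v → f (⊖ v) ≡ ⊖ f v) where

  preimage-subgroup : ∀ {K} → f 𝟘 ≡ 𝟘 → IsSubgroup K → IsSubgroup (K ∘ f)
  preimage-subgroup {K} f-𝟘 K-sg = record
    { has-𝟘    = subst K (sym f-𝟘) has-𝟘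
    ; closed-⊕ = λ {v} {w} kv kw → subst K (sym (f-⊕ v w)) (closed-⊕ kv kw)
    ; closed-⊖ = λ {v} kv → subst K (sym (f-⊖ v)) (closed-⊖ kv)
    }
    where open IsSubgroup K-sg

  preimage-index : ∀ {K n} (g : Λ → Λ) → (∀ u → f (g u) ≡ u) → HasIndex K n → HasIndex (K ∘ f) n
  preimage-index {K} g f∘g≡id (rep , covered , distinct) = g ∘ rep , covered′ , distinct′
    where
    f-⊝-g : ∀ v u → f (v ⊝ g u) ≡ f v ⊝ u
    f-⊝-g v u = trans (f-⊕ v (⊖ g u)) (cong (f v ⊕_) (trans (f-⊖ (g u)) (cong ⊖_ (f∘g≡id u))))

    covered′ : ∀ v → ∃ λ i → K (f (v ⊝ g (rep i)))
    covered′ v = proj₁ (covered (f v)) , subst K (sym (f-⊝-g v _)) (proj₂ (covered (f v)))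

    distinct′ : ∀ i j → K (f (g (rep i) ⊝ g (rep j))) → i ≡ j
    distinct′ i j k = distinct i j (subst K (trans (f-⊝-g _ _) (cong (_⊝ rep j) (f∘g≡id _))) k)

shear : Λ → Λ
shear (x , y) = x , x ℤ.+ y

unshear : Λ → Λ
unshear (x , y) = x , y ℤ.- x

shear-⊕ : ∀ v w → shear (v ⊕ w) ≡ shear v ⊕ shear w
shear-⊕ (a , b) (c , d) = cong (a ℤ.+ c ,_) (interchange a b c d)
  where
  interchange : ∀ a b c d → a ℤ.+ c ℤ.+ (b ℤ.+ d) ≡ a ℤ.+ b ℤ.+ (c ℤ.+ d)
  interchange = solve-∀

shear-⊖ : ∀ v → shear (⊖ v) ≡ ⊖ shear v
shear-⊖ (a , b) = cong (ℤ.- a ,_) (sym (ℤP.neg-distrib-+ a b))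

shear∘unshear : ∀ u → shear (unshear u) ≡ u
shear∘unshear (x , y) = cong (x ,_) (cancel x y)
  where
  cancel : ∀ x y → x ℤ.+ (y ℤ.- x) ≡ y
  cancel = solve-∀

Square : ℕ → Λ → Set
Square d = Congruence d d

Diamond : ℕ → Λ → Set
Diamond d = Congruence d (2 * d) ∘ shear

maps-onto : ∀ {K} (f g : Λ → Λ) → (∀ w → f (g w) ≡ w) →
            (∀ v → K v → K (f v)) → (∀ v → K v → K (g v)) → MapsOnto f K
maps-onto f g f∘g≡id K-f K-g = K-f , λ w k → g w , K-g w k , f∘g≡id w

ψ⁴≡id : ∀ w → ψ (ψ (ψ (ψ w))) ≡ w
ψ⁴≡id (a , b) = cong₂ _,_ (ℤP.neg-involutive a) (ℤP.neg-involutive b)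

r₁′²≡id : ∀ w → r₁' (r₁' w) ≡ w
r₁′²≡id (a , b) = cong (a ,_) (ℤP.neg-involutive b)

invariant : ∀ {K} → (∀ v → K v → K (ψ v)) → (∀ v → K v → K (r₁' v)) → Invariant K
invariant K-ψ K-r =
  maps-onto ψ (ψ ∘ ψ ∘ ψ) ψ⁴≡id K-ψ (λ v → K-ψ _ ∘ K-ψ _ ∘ K-ψ v) ,
  maps-onto r₁' r₁' r₁′²≡id K-r K-r

square-good : ∀ d .{{_ : NonZero d}} → Good (d * d) (Square d)
square-good d = congruence-subgroup d d , congruence-index d d ,
  invariant (λ _ (d∣x , d∣y) → ∣m⇒∣-m d∣y , d∣x) (λ _ (d∣x , d∣y) → d∣x , ∣m⇒∣-m d∣y)

module _ {d x y} (in-diamond : Diamond d (x , y)) where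

  diamond-∣-ordinate : + d ∣ℤ y
  diamond-∣-ordinate =
    ∣m+n∣m⇒∣n (ℤ∣.∣-trans (divides (+ 2) (ℤP.pos-* 2 d)) (proj₂ in-diamond)) (proj₁ in-diamond)

  diamond-∣-difference : + (2 * d) ∣ℤ x ℤ.- y
  diamond-∣-difference = subst (+ (2 * d) ∣ℤ_) (cancel x y) (∣m∣n⇒∣m-n (proj₂ in-diamond) 2d∣2y)
    where
    cancel : ∀ x y → x ℤ.+ y ℤ.- (y ℤ.+ y) ≡ x ℤ.- y
    cancel = solve-∀
    2d∣2y : + (2 * d) ∣ℤ y ℤ.+ y
    2d∣2y with divides q refl ← diamond-∣-ordinate =
      divides q (trans (double q (+ d)) (cong (q ℤ.*_) (sym (ℤP.pos-* 2 d))))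
      where
      double : ∀ q d → q ℤ.* d ℤ.+ q ℤ.* d ≡ q ℤ.* (+ 2 ℤ.* d)
      double = solve-∀

diamond-good : ∀ d .{{_ : NonZero d}} → Good (d * (2 * d)) (Diamond d)
diamond-good d =
  preimage-subgroup shear shear-⊕ shear-⊖ refl (congruence-subgroup d (2 * d)) ,
  preimage-index shear shear-⊕ shear-⊖ {Congruence d (2 * d)} unshear shear∘unshear
    (congruence-index d (2 * d)) ,
  invariant
    (λ (x , y) in-diamond → ∣m⇒∣-m (diamond-∣-ordinate in-diamond) ,
                             subst (+ (2 * d) ∣ℤ_) (ℤP.+-comm x (ℤ.- y)) (diamond-∣-difference in-diamond))
    (λ _ in-diamond → proj₁ in-diamond , diamond-∣-difference in-diamond)
  where instance _ = ℕP.m*n≢0 2 d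

-- Subgroups of finite index

module SubgroupProperties {K : Λ → Set} (K-sg : IsSubgroup K) where
  open IsSubgroup K-sg public

  closed-⊝ : ∀ {v w} → K v → K w → K (v ⊝ w)
  closed-⊝ kv kw = closed-⊕ kv (closed-⊖ kw)

  closed-·ℕ : ∀ n {v} → K v → K (+ n · v)
  closed-·ℕ zero    {a , b} _  = has-𝟘
  closed-·ℕ (suc n) {a , b} kv =
    subst K (sym (cong₂ _,_ (ℤP.suc-* (+ n) a) (ℤP.suc-* (+ n) b))) (closed-⊕ kv (closed-·ℕ n kv))

  closed-· : ∀ k {v} → K v → K (k · v)
  closed-· (+ n)    kv = closed-·ℕ n kv
  closed-· -[1+ n ] {a , b} kv =
    subst K (cong₂ _,_ (ℤP.neg-distribˡ-* (+ suc n) a) (ℤP.neg-distribˡ-* (+ suc n) b))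
      (closed-⊖ (closed-·ℕ (suc n) kv))

  shift-ordinate : ∀ {e x y} q → K (0ℤ , e) → K (x , y) → K (x , y ℤ.- q ℤ.* e)
  shift-ordinate {e} {x} {y} q K[0,e] k =
    subst (λ a → K (a , y ℤ.- q ℤ.* e)) (drop-zero x q) (closed-⊝ k (closed-· q K[0,e]))
    where
    drop-zero : ∀ x q → x ℤ.- q ℤ.* 0ℤ ≡ x
    drop-zero = solve-∀

  square⊆ : ∀ {d} → K (+ d , 0ℤ) → K (0ℤ , + d) → ∀ {v} → Square d v → K v
  square⊆ {d} K[d,0] K[0,d] {x , y} (divides a refl , divides b refl) =
    subst K (cong₂ _,_ (drop-zeroʳ a b (+ d)) (drop-zeroˡ a b (+ d)))
      (closed-⊕ (closed-· a K[d,0]) (closed-· b K[0,d]))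
    where
    drop-zeroʳ : ∀ a b D → a ℤ.* D ℤ.+ b ℤ.* 0ℤ ≡ a ℤ.* D
    drop-zeroʳ = solve-∀
    drop-zeroˡ : ∀ a b D → a ℤ.* 0ℤ ℤ.+ b ℤ.* D ≡ b ℤ.* D
    drop-zeroˡ = solve-∀

  diamond⊆ : ∀ {d} → K (+ d , + d) → K (0ℤ , + (2 * d)) → ∀ {v} → Diamond d v → K v
  diamond⊆ {d} K[d,d] K[0,2d] {x , y} (divides a refl , divides q x+y≡q2d) =
    subst K (cong₂ _,_ (drop-zero a (q ℤ.- a) (+ d)) ordinate)
      (closed-⊕ (closed-· a K[d,d]) (closed-· (q ℤ.- a) K[0,2d]))
    where
    open ≡-Reasoning
    D : ℤ
    D = + d
    drop-zero : ∀ a b D → a ℤ.* D ℤ.+ b ℤ.* 0ℤ ≡ a ℤ.* D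
    drop-zero = solve-∀
    rearrange : ∀ a q D → a ℤ.* D ℤ.+ (q ℤ.- a) ℤ.* (+ 2 ℤ.* D) ≡ q ℤ.* (+ 2 ℤ.* D) ℤ.- a ℤ.* D
    rearrange = solve-∀
    cancel : ∀ x y → x ℤ.+ y ℤ.- x ≡ y
    cancel = solve-∀
    ordinate : a ℤ.* D ℤ.+ (q ℤ.- a) ℤ.* + (2 * d) ≡ y
    ordinate = begin
      a ℤ.* D ℤ.+ (q ℤ.- a) ℤ.* + (2 * d)  ≡⟨ cong (λ e → a ℤ.* D ℤ.+ (q ℤ.- a) ℤ.* e) (ℤP.pos-* 2 d) ⟩
      a ℤ.* D ℤ.+ (q ℤ.- a) ℤ.* (+ 2 ℤ.* D) ≡⟨ rearrange a q D ⟩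
      q ℤ.* (+ 2 ℤ.* D) ℤ.- a ℤ.* D        ≡⟨ cong (λ e → q ℤ.* e ℤ.- a ℤ.* D) (ℤP.pos-* 2 d) ⟨
      q ℤ.* + (2 * d) ℤ.- a ℤ.* D          ≡⟨ cong (ℤ._- a ℤ.* D) x+y≡q2d ⟨
      a ℤ.* D ℤ.+ y ℤ.- a ℤ.* D            ≡⟨ cancel (a ℤ.* D) y ⟩
      y                                    ∎

  infix 4 _∼_
  _∼_ : Λ → Λ → Set
  v ∼ w = K (v ⊝ w)

  ∼-sym : ∀ {v w} → v ∼ w → w ∼ v
  ∼-sym {a , b} {c , d} v∼w = subst K (cong₂ _,_ (neg-minus a c) (neg-minus b d)) (closed-⊖ v∼w)
    where
    neg-minus : ∀ x y → ℤ.- (x ℤ.- y) ≡ y ℤ.- x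
    neg-minus = solve-∀

  ∼-trans : ∀ {u v w} → u ∼ v → v ∼ w → u ∼ w
  ∼-trans {a , b} {c , d} {e , f} u∼v v∼w =
    subst K (cong₂ _,_ (ℤP.+-minus-telescope a c e) (ℤP.+-minus-telescope b d f)) (closed-⊕ u∼v v∼w)

  ∼𝟘⇔ : ∀ v → v ∼ 𝟘 ⇔ K v
  ∼𝟘⇔ (a , b) = mk⇔ (subst K v⊝𝟘≡v) (subst K (sym v⊝𝟘≡v))
    where
    v⊝𝟘≡v : (a , b) ⊝ 𝟘 ≡ (a , b)
    v⊝𝟘≡v = cong₂ _,_ (ℤP.+-identityʳ a) (ℤP.+-identityʳ b)

module Cosets {K : Λ → Set} (K-sg : IsSubgroup K) {n : ℕ} (index : HasIndex K n) where
  open SubgroupProperties K-sg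

  rep : Fin n → Λ
  rep = proj₁ index

  coset : Λ → Fin n
  coset v = proj₁ (proj₁ (proj₂ index) v)

  ∼-rep : ∀ v → v ∼ rep (coset v)
  ∼-rep v = proj₂ (proj₁ (proj₂ index) v)

  rep-injective : ∀ i j → rep i ∼ rep j → i ≡ j
  rep-injective = proj₂ (proj₂ index)

  ∼⇔coset≡ : ∀ v w → v ∼ w ⇔ coset v ≡ coset w
  ∼⇔coset≡ v w = mk⇔
    (λ v∼w → rep-injective _ _
      (∼-trans {u = rep (coset v)} (∼-sym {v} (∼-rep v)) (∼-trans {v} v∼w (∼-rep w))))
    (λ eq → ∼-trans {v} (∼-rep v) (∼-sym {w} (subst (λ i → w ∼ rep i) (sym eq) (∼-rep w))))

  K? : ∀ v → Dec (K v)
  K? v = Dec.map′ (to (∼𝟘⇔ v) ∘ from (∼⇔coset≡ v 𝟘)) (to (∼⇔coset≡ v 𝟘) ∘ from (∼𝟘⇔ v))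
           (coset v Fin.≟ coset 𝟘)
    where open Equivalence

index-unique : ∀ {K} → IsSubgroup K → ∀ {m n} → HasIndex K m → HasIndex K n → m ≡ n
index-unique {K} K-sg idx idx′ = ℕP.≤-antisym (index-≤ idx idx′) (index-≤ idx′ idx)
  where
  index-≤ : ∀ {m n} → HasIndex K m → HasIndex K n → m ≤ n
  index-≤ idx idx′ = FinP.injective⇒≤ λ {i} {j} eq →
    C.rep-injective i j (Equivalence.from (C′.∼⇔coset≡ (C.rep i) (C.rep j)) eq)
    where
    module C = Cosets K-sg idx
    module C′ = Cosets K-sg idx′

HasIndex-resp : ∀ {K K′ n} → K ≐ K′ → HasIndex K n → HasIndex K′ n
HasIndex-resp K≐K′ (rep , covered , distinct) =
  rep ,
  (λ v → proj₁ (covered v) , Equivalence.to (K≐K′ _) (proj₂ (covered v))) ,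
  (λ i j k → distinct i j (Equivalence.from (K≐K′ _) k))

-- Classification of the invariant subgroups

least-witness : ∀ {P : ℕ → Set} → (∀ k → Dec (P k)) → ∀ {m} → P m →
                ∃ λ d → P d × (∀ e → e < d → ¬ P e)
least-witness {P} P? {m} Pm
  with i , ¬¬Pi , smaller ← FinP.¬∀⟶∃¬-smallest (suc m) (λ i → ¬ P (toℕ i)) (λ i → Dec.¬? (P? (toℕ i)))
                              (λ none → none (Fin.fromℕ m) (subst P (sym (FinP.toℕ-fromℕ m)) Pm)) =
  toℕ i , Dec.decidable-stable (P? (toℕ i)) ¬¬Pi ,
  λ e e<i → subst (¬_ ∘ P) (trans (FinP.toℕ-inject (fromℕ< e<i)) (FinP.toℕ-fromℕ< e<i)) (smaller (fromℕ< e<i))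

Classified : ℕ → (Λ → Set) → Set
Classified n K = ∃ λ d → (n ≡ d * d × K ≐ Square d) ⊎ (n ≡ d * (2 * d) × K ≐ Diamond d)

module Classification {n : ℕ} {K : Λ → Set} (K-sg : IsSubgroup K) (index : HasIndex K n)
                      (K-ψ : ∀ v → K v → K (ψ v)) (K-r : ∀ v → K v → K (r₁' v)) where
  open SubgroupProperties K-sg
  open Cosets K-sg index

  axis-point : ∃ λ c → NonZero c × K (+ c , 0ℤ)
  axis-point
    with i , j , i<j , same ← FinP.pigeonhole (ℕP.n<1+n n) (λ (i : Fin (suc n)) → coset (+ toℕ i , 0ℤ)) =
    toℕ j ∸ toℕ i , ≢-nonZero (ℕP.m>n⇒m∸n≢0 i<j) ,
    subst (λ x → K (x , 0ℤ)) (trans (ℤP.[+m]-[+n]≡m⊖n (toℕ j) (toℕ i)) (ℤP.⊖-≥ (ℕP.<⇒≤ i<j)))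
      (Equivalence.from (∼⇔coset≡ (+ toℕ j , 0ℤ) (+ toℕ i , 0ℤ)) (sym same))

  module _ (c : ℕ) .{{_ : NonZero c}} (K[c,0] : K (+ c , 0ℤ)) where

    reduce-ordinate-mod-c : ∀ {x y} → K (x , y) → K (x , + (y %ℕ c))
    reduce-ordinate-mod-c {x} {y} k =
      subst (λ b → K (x , b)) (%ℕ-as-difference y c) (shift-ordinate (y /ℕ c) (K-ψ _ K[c,0]) k)

    -- Ordinates may be taken modulo c, so whether e is an abscissa of K is decidable.
    Abscissa : ℕ → Set
    Abscissa e = 0 < e × ∃ λ (j : Fin c) → K (+ e , + toℕ j)

    abscissa? : ∀ e → Dec (Abscissa e)
    abscissa? e = (0 ℕP.<? e) Dec.×-dec FinP.any? (λ j → K? (+ e , + toℕ j))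

    abscissa : ∀ {e y} → 0 < e → K (+ e , y) → Abscissa e
    abscissa {y = y} 0<e k =
      0<e , residue c y , subst (λ r → K (_ , + r)) (sym (FinP.toℕ-fromℕ< _)) (reduce-ordinate-mod-c k)

    LeastAbscissa : Set
    LeastAbscissa = ∃₂ λ d₀ Y → K (+ suc d₀ , Y) × (∀ {r y} → r < suc d₀ → K (+ r , y) → r ≡ 0)

    least-abscissa : LeastAbscissa
    least-abscissa = from-least (least-witness abscissa? (abscissa (>-nonZero⁻¹ c) K[c,0]))
      where
      from-least : (∃ λ d → Abscissa d × (∀ e → e < d → ¬ Abscissa e)) → LeastAbscissa
      from-least (suc d₀ , (_ , j , k) , smaller) = d₀ , + toℕ j , k , least
        where
        least : ∀ {r y} → r < suc d₀ → K (+ r , y) → r ≡ 0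
        least {zero}  _   _ = refl
        least {suc r} r<d k = contradiction (abscissa (s≤s z≤n) k) (smaller (suc r) r<d)

  module _ (d₀ : ℕ) (Y : ℤ) (K[d,Y] : K (+ suc d₀ , Y))
           (least : ∀ {r y} → r < suc d₀ → K (+ r , y) → r ≡ 0) where

    -- As d is a successor, + (2 * d) and + 2 ℤ.* + d are definitionally equal; the ring
    -- identities below are stated with the latter.
    d : ℕ
    d = suc d₀

    d∣abscissa : ∀ {x y} → K (x , y) → + d ∣ℤ x
    d∣abscissa {x} {y} k = divides (x /ℕ d) (begin
      x                               ≡⟨ a≡a%ℕn+[a/ℕn]*n x d ⟩
      + (x %ℕ d) ℤ.+ x /ℕ d ℤ.* + d   ≡⟨ cong (λ r → + r ℤ.+ x /ℕ d ℤ.* + d) remainder≡0 ⟩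
      0ℤ ℤ.+ x /ℕ d ℤ.* + d           ≡⟨ ℤP.+-identityˡ _ ⟩
      x /ℕ d ℤ.* + d                  ∎)
      where
      open ≡-Reasoning
      remainder≡0 : x %ℕ d ≡ 0
      remainder≡0 = least (n%ℕd<d x d)
        (subst (λ a → K (a , y ℤ.- x /ℕ d ℤ.* Y)) (%ℕ-as-difference x d)
          (closed-⊝ k (closed-· (x /ℕ d) K[d,Y])))

    d∣ordinate : ∀ {x y} → K (x , y) → + d ∣ℤ y
    d∣ordinate {y = y} k = subst (+ d ∣ℤ_) (ℤP.neg-involutive y) (∣m⇒∣-m (d∣abscissa (K-ψ _ k)))

    K[0,2d] : K (0ℤ , + (2 * d))
    K[0,2d] = subst K (cong₂ _,_ (cancel Y) (double (+ d))) (K-ψ _ (closed-⊕ K[d,Y] (K-r _ K[d,Y])))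
      where
      cancel : ∀ y → ℤ.- (y ℤ.+ ℤ.- y) ≡ 0ℤ
      cancel = solve-∀
      double : ∀ D → D ℤ.+ D ≡ + 2 ℤ.* D
      double = solve-∀

    reduce-ordinate-mod-2d : ∀ {x} t → K (x , t ℤ.* + d) → K (x , + (t %ℕ 2) ℤ.* + d)
    reduce-ordinate-mod-2d {x} t k = subst (λ b → K (x , b)) (begin
        t ℤ.* + d ℤ.- q ℤ.* + (2 * d)                         ≡⟨ cong (λ s → s ℤ.* + d ℤ.- q ℤ.* + (2 * d))
                                                                        (a≡a%ℕn+[a/ℕn]*n t 2) ⟩
        (+ (t %ℕ 2) ℤ.+ q ℤ.* + 2) ℤ.* + d ℤ.- q ℤ.* + (2 * d) ≡⟨ cancel (+ (t %ℕ 2)) q (+ d) ⟩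
        + (t %ℕ 2) ℤ.* + d                                    ∎)
      (shift-ordinate q K[0,2d] k)
      where
      open ≡-Reasoning
      q : ℤ
      q = t /ℕ 2
      cancel : ∀ r q D → (r ℤ.+ q ℤ.* + 2) ℤ.* D ℤ.- q ℤ.* (+ 2 ℤ.* D) ≡ r ℤ.* D
      cancel = solve-∀

    square-case : K (+ d , 0ℤ) → n ≡ d * d × K ≐ Square d
    square-case K[d,0] =
      index-unique (congruence-subgroup d d) (HasIndex-resp K≐square index) (congruence-index d d) ,
      K≐square
      where
      K≐square : K ≐ Square d
      K≐square v = mk⇔ (λ k → d∣abscissa k , d∣ordinate k) (square⊆ K[d,0] (K-ψ _ K[d,0]))

    module _ (¬K[d,0] : ¬ K (+ d , 0ℤ)) where

      K[d,d] : K (+ d , + d)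
      K[d,d] with divides t Y≡td ← d∣ordinate K[d,Y] =
        odd-case (t %ℕ 2) (n%ℕd<d t 2) (reduce-ordinate-mod-2d t (subst (λ y → K (+ d , y)) Y≡td K[d,Y]))
        where
        odd-case : ∀ ρ → ρ < 2 → K (+ d , + ρ ℤ.* + d) → K (+ d , + d)
        odd-case 0 _ k = contradiction k ¬K[d,0]
        odd-case 1 _ k = subst (λ y → K (+ d , y)) (ℤP.*-identityˡ (+ d)) k
        odd-case (suc (suc _)) (s≤s (s≤s ())) _

      vertical⇒2d∣ordinate : ∀ {w} → K (0ℤ , w) → + (2 * d) ∣ℤ w
      vertical⇒2d∣ordinate k with divides t refl ← d∣ordinate k =
        even-case (t %ℕ 2) (n%ℕd<d t 2) (a≡a%ℕn+[a/ℕn]*n t 2) (reduce-ordinate-mod-2d t k)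
        where
        even-case : ∀ ρ → ρ < 2 → t ≡ + ρ ℤ.+ t /ℕ 2 ℤ.* + 2 → K (0ℤ , + ρ ℤ.* + d) →
                    + (2 * d) ∣ℤ t ℤ.* + d
        even-case 0 _ t≡2q _ = divides (t /ℕ 2) (trans (cong (ℤ._* + d) t≡2q) (regroup (t /ℕ 2) (+ d)))
          where
          regroup : ∀ q D → (0ℤ ℤ.+ q ℤ.* + 2) ℤ.* D ≡ q ℤ.* (+ 2 ℤ.* D)
          regroup = solve-∀
        even-case 1 _ _ k =
          contradiction (closed-⊖ (K-ψ _ (subst (λ y → K (0ℤ , y)) (ℤP.*-identityˡ (+ d)) k))) ¬K[d,0]
        even-case (suc (suc _)) (s≤s (s≤s ())) _ _

      K⊆diamond : ∀ {x y} → K (x , y) → Diamond d (x , y)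
      K⊆diamond {x} {y} k with divides a refl ← d∣abscissa k =
        divides a refl ,
        subst (+ (2 * d) ∣ℤ_) (regroup a y (+ d)) (∣m∣n⇒∣m+n (vertical⇒2d∣ordinate K[0,y-ad]) (divides a refl))
        where
        K[0,y-ad] : K (0ℤ , y ℤ.- a ℤ.* + d)
        K[0,y-ad] = subst (λ u → K (u , y ℤ.- a ℤ.* + d)) (ℤP.+-inverseʳ (a ℤ.* + d))
                      (closed-⊝ k (closed-· a K[d,d]))
        regroup : ∀ a y D → y ℤ.- a ℤ.* D ℤ.+ a ℤ.* (+ 2 ℤ.* D) ≡ a ℤ.* D ℤ.+ y
        regroup = solve-∀

      diamond-case : n ≡ d * (2 * d) × K ≐ Diamond d
      diamond-case =
        index-unique (proj₁ (diamond-good d)) (HasIndex-resp K≐diamond index) (proj₁ (proj₂ (diamond-good d))) ,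
        K≐diamond
        where
        K≐diamond : K ≐ Diamond d
        K≐diamond v = mk⇔ K⊆diamond (diamond⊆ K[d,d] K[0,2d])

    classified : Classified n K
    classified with K? (+ d , 0ℤ)
    ... | yes K[d,0] = d , inj₁ (square-case K[d,0])
    ... | no ¬K[d,0] = d , inj₂ (diamond-case ¬K[d,0])

  classify : Classified n K
  classify =
    let c , c≢0 , K[c,0] = axis-point
        d₀ , Y , K[d,Y] , least = least-abscissa c {{c≢0}} K[c,0]
    in classified d₀ Y K[d,Y] least

classify : ∀ {n K} → Good n K → Classified n K
classify (K-sg , index , (K-ψ , _) , (K-r , _)) = Classification.classify K-sg index K-ψ K-r

-- p-adic valuations

^-∣-^ : ∀ p {j k} → j ≤ k → p ^ j ∣ p ^ k
^-∣-^ p {j} j≤k with o , refl ← ℕP.m≤n⇒∃[o]m+o≡n j≤k =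
  subst (p ^ j ∣_) (sym (ℕP.^-distribˡ-+-* p j o)) (m∣m*n (p ^ o))

val-unique : ∀ {p n j k} → Val p n j → Val p n k → j ≡ k
val-unique {p} {j = j} {k} (p^j∣n , p^1+j∤n) (p^k∣n , p^1+k∤n) with ℕP.<-cmp j k
... | tri< j<k _ _ = contradiction (∣-trans (^-∣-^ p j<k) p^k∣n) p^1+j∤n
... | tri≈ _ j≡k _ = j≡k
... | tri> _ _ k<j = contradiction (∣-trans (^-∣-^ p k<j) p^j∣n) p^1+k∤n

val⇒factorisation : ∀ {p n k} → Val p n k → ∃ λ m → n ≡ p ^ k * m × ¬ p ∣ m
val⇒factorisation {p} {k = k} (divides m refl , p^1+k∤n) =
  m , ℕP.*-comm m (p ^ k) , λ p∣m → p^1+k∤n (*-pres-∣ p∣m (∣-refl {p ^ k}))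

factorisation⇒val : ∀ {p m} k .{{_ : NonZero p}} → ¬ p ∣ m → Val p (p ^ k * m) k
factorisation⇒val {p} {m} k p∤m =
  m∣m*n m , λ p^1+k∣ → p∤m (*-cancelˡ-∣ (p ^ k) (subst (_∣ p ^ k * m) (ℕP.*-comm p (p ^ k)) p^1+k∣))
  where instance _ = ℕP.m^n≢0 p k

val-* : ∀ {p a b j k} → Prime p → Val p a j → Val p b k → Val p (a * b) (j + k)
val-* {p} {j = j} {k} p-prime val-a val-b
  with a′ , refl , p∤a′ ← val⇒factorisation {p} {k = j} val-a
     | b′ , refl , p∤b′ ← val⇒factorisation {p} {k = k} val-b
  = subst (λ n → Val p n (j + k)) p^[j+k]a′b′≡ (factorisation⇒val (j + k) p∤a′b′)
  where
  instance _ = prime⇒nonZero p-prime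
  p∤a′b′ : ¬ p ∣ a′ * b′
  p∤a′b′ p∣a′b′ = [ p∤a′ , p∤b′ ] (euclidsLemma a′ b′ p-prime p∣a′b′)
  rearrange : ∀ x y a b → x * y * (a * b) ≡ x * a * (y * b)
  rearrange = ℕ-Solver.solve-∀
  p^[j+k]a′b′≡ : p ^ (j + k) * (a′ * b′) ≡ p ^ j * a′ * (p ^ k * b′)
  p^[j+k]a′b′≡ = trans (cong (_* (a′ * b′)) (ℕP.^-distribˡ-+-* p j k)) (rearrange (p ^ j) (p ^ k) a′ b′)

∤⇒val-0 : ∀ {p m} → ¬ p ∣ m → Val p m 0
∤⇒val-0 {p} {m} p∤m = 1∣ m , λ p*1∣m → p∤m (subst (_∣ m) (ℕP.*-identityʳ p) p*1∣m)

val-self : ∀ {p} → Prime p → Val p p 1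
val-self {p} p-prime =
  subst (λ n → Val p n 1) (trans (ℕP.*-identityʳ (p * 1)) (ℕP.*-identityʳ p)) (factorisation⇒val 1 p∤1)
  where
  instance _ = prime⇒nonZero p-prime
  p∤1 : ¬ p ∣ 1
  p∤1 p∣1 = ¬prime[1] (subst Prime (∣1⇒≡1 p∣1) p-prime)

prime>1 : ∀ {p} → Prime p → 1 < p
prime>1 (prime {{nontrivial}} _) = nonTrivial⇒n>1 _

val-exists : ∀ {p} → Prime p → ∀ n .{{_ : NonZero n}} → ∃ (Val p n)
val-exists {p} p-prime = <-rec (λ n → .{{NonZero n}} → ∃ (Val p n)) go
  where
  go : ∀ n → (∀ {m} → m < n → .{{NonZero m}} → ∃ (Val p m)) → .{{NonZero n}} → ∃ (Val p n)
  go n rec with p ∣? n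
  ... | no p∤n = 0 , ∤⇒val-0 p∤n
  ... | yes (divides q refl) =
    let instance _ = ℕP.m*n≢0⇒m≢0 q
        k , val-q = rec (ℕP.m<m*n q p (prime>1 p-prime))
    in suc k , subst (Val p (q * p)) (ℕP.+-comm k 1) (val-* {j = k} {1} p-prime val-q (val-self p-prime))

prime∤^ : ∀ {p q} → Prime q → Prime p → q ≢ p → ∀ k → ¬ q ∣ p ^ k
prime∤^ q-prime p-prime q≢p zero    q∣1     = ¬prime[1] (subst Prime (∣1⇒≡1 q∣1) q-prime)
prime∤^ {p} q-prime p-prime q≢p (suc k) q∣p^1+k with euclidsLemma p (p ^ k) q-prime q∣p^1+k
... | inj₂ q∣p^k = prime∤^ q-prime p-prime q≢p k q∣p^k
... | inj₁ q∣p   = [ (λ q≡1 → ¬prime[1] (subst Prime q≡1 q-prime)) , q≢p ] (prime⇒irreducible p-prime q∣p)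

parity : ∀ k → ∃ λ i → k ≡ 2 * i ⊎ k ≡ suc (2 * i)
parity zero = 0 , inj₁ refl
parity (suc k) with parity k
... | i , inj₁ refl = i , inj₂ refl
... | i , inj₂ refl = suc i , inj₁ (cong suc (sym (ℕP.+-suc i (i + 0))))

j+j≡2*j : ∀ j → j + j ≡ 2 * j
j+j≡2*j j = cong (_+_ j) (sym (ℕP.+-identityʳ j))

¬odd-double : ∀ i → ¬ Odd (2 * i)
¬odd-double i (j , 2i≡1+2j) = ℕP.even≢odd i j 2i≡1+2j

prime⇒≡2⊎odd : ∀ {p} → Prime p → p ≡ 2 ⊎ Odd p
prime⇒≡2⊎odd {p} p-prime with parity p
... | i , inj₂ p≡1+2i = inj₂ (i , p≡1+2i)
... | i , inj₁ p≡2i with prime⇒irreducible p-prime (divides i (trans p≡2i (ℕP.*-comm 2 i)))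
...   | inj₁ ()
...   | inj₂ 2≡p = inj₁ (sym 2≡p)

odd-prime∤2 : ∀ {p} → Prime p → Odd p → ¬ p ∣ 2
odd-prime∤2 p-prime (i , p≡1+2i) p∣2 with prime⇒irreducible prime[2] p∣2
... | inj₁ refl = ¬prime[1] p-prime
... | inj₂ refl = ℕP.even≢odd 1 i p≡1+2i

-- Squares and twice squares

val-square : ∀ {p} → Prime p → ∀ d .{{_ : NonZero d}} → ∃ λ j → Val p (d * d) (2 * j)
val-square p-prime d with j , val-d ← val-exists p-prime d =
  j , subst (Val _ (d * d)) (j+j≡2*j j) (val-* {j = j} {j} p-prime val-d val-d)

val-twice-square : ∀ {p} → Prime p → ¬ p ∣ 2 → ∀ d .{{_ : NonZero d}} →
                   ∃ λ j → Val p (d * (2 * d)) (2 * j)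
val-twice-square p-prime p∤2 d with j , val-d ← val-exists p-prime d =
  j , subst (Val _ (d * (2 * d))) (j+j≡2*j j)
        (val-* {j = j} {j} p-prime val-d (val-* {j = 0} {j} p-prime (∤⇒val-0 p∤2) val-d))

val₂-twice-square : ∀ d .{{_ : NonZero d}} → ∃ λ j → Val 2 (d * (2 * d)) (suc (2 * j))
val₂-twice-square d with j , val-d ← val-exists prime[2] d =
  j , subst (Val 2 (d * (2 * d))) (trans (ℕP.+-suc j j) (cong suc (j+j≡2*j j)))
        (val-* {j = j} {suc j} prime[2] val-d (val-* {j = 1} {j} prime[2] (val-self prime[2]) val-d))

nonZero-factorˡ : ∀ {n d e} .{{_ : NonZero n}} → n ≡ d * e → NonZero d
nonZero-factorˡ {d = d} refl = ℕP.m*n≢0⇒m≢0 d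

SquareOrTwiceSquare : ℕ → Set
SquareOrTwiceSquare n = ∃ λ d → n ≡ d * d ⊎ n ≡ d * (2 * d)

square-or-twice-square⇒¬odd-val : ∀ {n} .{{_ : NonZero n}} → SquareOrTwiceSquare n → ¬ OddValAtOddPrime n
square-or-twice-square⇒¬odd-val (d , inj₁ refl) (p , p-prime , _ , k , val-n , k-odd) =
  let j , val-d² = val-square p-prime d {{ℕP.m*n≢0⇒m≢0 d}}
  in ¬odd-double j (subst Odd (val-unique val-n val-d²) k-odd)
square-or-twice-square⇒¬odd-val (d , inj₂ refl) (p , p-prime , p-odd , k , val-n , k-odd) =
  let j , val-2d² = val-twice-square p-prime (odd-prime∤2 p-prime p-odd) d {{ℕP.m*n≢0⇒m≢0 d}}
  in ¬odd-double j (subst Odd (val-unique val-n val-2d²) k-odd)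

square≢twice-square : ∀ d e .{{_ : NonZero d}} → d * d ≢ e * (2 * e)
square≢twice-square d e d²≡2e² =
  let instance _ = nonZero-factorˡ {{ℕP.m*n≢0 d d}} d²≡2e²
      j , val-d²  = val-square prime[2] d
      i , val-2e² = val₂-twice-square e
  in ℕP.even≢odd j i (val-unique val-d² (subst (λ n → Val 2 n (suc (2 * i))) (sym d²≡2e²) val-2e²))

*-self-injective : ∀ {d e} → d * d ≡ e * e → d ≡ e
*-self-injective {d} {e} d²≡e² with ℕP.<-cmp d e
... | tri< d<e _ _ = contradiction d²≡e² (ℕP.<⇒≢ (ℕP.*-mono-< d<e d<e))
... | tri≈ _ d≡e _ = d≡e
... | tri> _ _ e<d = contradiction (sym d²≡e²) (ℕP.<⇒≢ (ℕP.*-mono-< e<d e<d))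

twice-square-injective : ∀ {d e} → d * (2 * d) ≡ e * (2 * e) → d ≡ e
twice-square-injective {d} {e} 2d²≡2e² = *-self-injective (ℕP.*-cancelˡ-≡ (d * d) (e * e) 2 (begin
  2 * (d * d)   ≡⟨ twice-square d ⟨
  d * (2 * d)   ≡⟨ 2d²≡2e² ⟩
  e * (2 * e)   ≡⟨ twice-square e ⟩
  2 * (e * e)   ∎))
  where
  open ≡-Reasoning
  twice-square : ∀ x → x * (2 * x) ≡ 2 * (x * x)
  twice-square = ℕ-Solver.solve-∀

square-or-twice-square-*-square : ∀ {m} P → SquareOrTwiceSquare m → SquareOrTwiceSquare (P * P * m)
square-or-twice-square-*-square P (e , inj₁ refl) = P * e , inj₁ (square P e)
  where
  square : ∀ P e → P * P * (e * e) ≡ P * e * (P * e)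
  square = ℕ-Solver.solve-∀
square-or-twice-square-*-square P (e , inj₂ refl) = P * e , inj₂ (twice-square P e)
  where
  twice-square : ∀ P e → P * P * (e * (2 * e)) ≡ P * e * (2 * (P * e))
  twice-square = ℕ-Solver.solve-∀

square-or-twice-square-*-twice-square : ∀ {m} P → SquareOrTwiceSquare m →
                                        SquareOrTwiceSquare (2 * (P * P) * m)
square-or-twice-square-*-twice-square P (e , inj₁ refl) = P * e , inj₂ (twice-square P e)
  where
  twice-square : ∀ P e → 2 * (P * P) * (e * e) ≡ P * e * (2 * (P * e))
  twice-square = ℕ-Solver.solve-∀
square-or-twice-square-*-twice-square P (e , inj₂ refl) = 2 * (P * e) , inj₁ (square P e)
  where
  square : ∀ P e → 2 * (P * P) * (e * (2 * e)) ≡ 2 * (P * e) * (2 * (P * e))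
  square = ℕ-Solver.solve-∀

^-double : ∀ p i → p ^ (2 * i) ≡ p ^ i * p ^ i
^-double p i = trans (cong (p ^_) (sym (j+j≡2*j i))) (ℕP.^-distribˡ-+-* p i i)

Dichotomy : ℕ → Set
Dichotomy n = SquareOrTwiceSquare n ⊎ OddValAtOddPrime n

dichotomy-*-prime-power : ∀ {p m} → Prime p → ¬ p ∣ m → ∀ k → Dichotomy m → Dichotomy (p ^ k * m)
dichotomy-*-prime-power {p} {m} p-prime p∤m k (inj₂ (q , q-prime , q-odd , _ , val-m , (i , refl))) =
  inj₂ (q , q-prime , q-odd , suc (2 * i) ,
        val-* {j = 0} {suc (2 * i)} q-prime (∤⇒val-0 q∤p^k) val-m , (i , refl))
  where
  q∤p^k : ¬ q ∣ p ^ k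
  q∤p^k = prime∤^ q-prime p-prime (λ { refl → p∤m (∣-trans (m∣m*n (p ^ (2 * i))) (proj₁ val-m)) }) k
dichotomy-*-prime-power {p} p-prime p∤m k (inj₁ m-shape) with parity k
... | i , inj₁ refl = inj₁ (subst SquareOrTwiceSquare (cong (_* _) (sym (^-double p i)))
                                (square-or-twice-square-*-square (p ^ i) m-shape))
... | i , inj₂ refl with prime⇒≡2⊎odd p-prime
...   | inj₂ p-odd = inj₂ (p , p-prime , p-odd , suc (2 * i) ,
                           factorisation⇒val (suc (2 * i)) {{prime⇒nonZero p-prime}} p∤m , (i , refl))
...   | inj₁ refl = inj₁ (subst SquareOrTwiceSquare (cong (λ x → 2 * x * _) (sym (^-double 2 i)))
                          (square-or-twice-square-*-twice-square (2 ^ i) m-shape))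

prime-divisor : ∀ n → 1 < n → ∃ λ p → Prime p × p ∣ n
prime-divisor n@(suc _) 1<n with PrimeFactorisation.factors (factorise n)
                               | PrimeFactorisation.isFactorisation (factorise n)
                               | PrimeFactorisation.factorsPrime (factorise n)
... | []     | n≡1    | _           = contradiction (sym n≡1) (ℕP.<⇒≢ 1<n)
... | p ∷ ps | n≡p*ps | p-prime ∷ _ =
  p , p-prime , divides (product ps) (trans n≡p*ps (ℕP.*-comm p (product ps)))

dichotomy : ∀ n .{{_ : NonZero n}} → Dichotomy n
dichotomy = <-rec (λ n → .{{NonZero n}} → Dichotomy n) go
  where
  go : ∀ n → (∀ {m} → m < n → .{{NonZero m}} → Dichotomy m) → .{{NonZero n}} → Dichotomy n
  go 1 _ = inj₁ (1 , inj₁ refl)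
  go n@(suc (suc _)) rec
    with p , p-prime , p∣n ← prime-divisor n (s≤s (s≤s z≤n))
    with k , val-n ← val-exists p-prime n
    with m , n≡p^k*m , p∤m ← val⇒factorisation {p} {k = k} val-n
    with k
  ... | zero   = contradiction (subst (p ∣_) (trans n≡p^k*m (ℕP.*-identityˡ m)) p∣n) p∤m
  ... | suc k′ = subst Dichotomy (sym n≡p^k*m) (dichotomy-*-prime-power p-prime p∤m (suc k′) (rec m<n))
    where
    instance _ = ℕP.m*n≢0⇒n≢0 (p ^ suc k′) {{subst NonZero n≡p^k*m _}}
    m<n : m < n
    m<n = subst (m <_) (trans (ℕP.*-comm m _) (sym n≡p^k*m))
            (ℕP.m<m*n m (p ^ suc k′) (ℕP.^-monoʳ-< p (prime>1 p-prime) {0} {suc k′} (s≤s z≤n)))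

classified⇒square-or-twice-square : ∀ {n K} → Classified n K → SquareOrTwiceSquare n
classified⇒square-or-twice-square (d , inj₁ (n≡d² , _))  = d , inj₁ n≡d²
classified⇒square-or-twice-square (d , inj₂ (n≡2d² , _)) = d , inj₂ n≡2d²

square-unique : ∀ {n d K} .{{_ : NonZero n}} → n ≡ d * d → Classified n K → Square d ≐ K
square-unique n≡d² (d′ , inj₁ (n≡d′² , K≐square)) =
  subst (λ e → Square e ≐ _) (sym (*-self-injective (trans (sym n≡d²) n≡d′²))) (≐-sym K≐square)
square-unique {d = d} n≡d² (d′ , inj₂ (n≡2d′² , _)) =
  contradiction (trans (sym n≡d²) n≡2d′²) (square≢twice-square d d′ {{nonZero-factorˡ n≡d²}})

diamond-unique : ∀ {n d K} .{{_ : NonZero n}} → n ≡ d * (2 * d) → Classified n K → Diamond d ≐ K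
diamond-unique n≡2d² (d′ , inj₂ (n≡2d′² , K≐diamond)) =
  subst (λ e → Diamond e ≐ _) (sym (twice-square-injective (trans (sym n≡2d²) n≡2d′²))) (≐-sym K≐diamond)
diamond-unique {d = d} n≡2d² (d′ , inj₁ (n≡d′² , _)) =
  contradiction (trans (sym n≡d′²) n≡2d²) (square≢twice-square d′ d {{nonZero-factorˡ n≡d′²}})

lemma6 : (n : ℕ) → n ≥ 1 →
    (OddValAtOddPrime n → NoneGood n) × (¬ OddValAtOddPrime n → UniqueGood n)
lemma6 n n≥1 = none , unique (dichotomy n)
  where
  instance _ = >-nonZero n≥1

  none : OddValAtOddPrime n → NoneGood n
  none odd-val K good =
    square-or-twice-square⇒¬odd-val (classified⇒square-or-twice-square (classify good)) odd-val

  unique : Dichotomy n → ¬ OddValAtOddPrime n → UniqueGood n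
  unique (inj₂ odd-val) ¬odd-val = contradiction odd-val ¬odd-val
  unique (inj₁ (d , inj₁ n≡d²)) _ = let instance _ = nonZero-factorˡ n≡d² in
    Square d , subst (λ m → Good m (Square d)) (sym n≡d²) (square-good d) ,
    λ K → square-unique n≡d² ∘ classify
  unique (inj₁ (d , inj₂ n≡2d²)) _ = let instance _ = nonZero-factorˡ n≡2d² in
    Diamond d , subst (λ m → Good m (Diamond d)) (sym n≡2d²) (diamond-good d) ,
    λ K → diamond-unique n≡2d² ∘ classify
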